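{- For every integer $n\ge 0$, the following identity holds in $\mathbb{F}_2[x]$: $$\prod_{k=0}^{2^n-1}\left(1+\sum_{j=0}^{k}\binom{k}{j}x^{2^j}\right)=x^{2^{2^n}-1}+1,$$ where the binomial coefficients $\binom{k}{j}$ are reduced modulo $2$. -}

module Defs where

open import Data.Bool using (Bool; true; false; _xor_; _∧_; if_then_else_)
open import Data.List using (List; []; _∷_; replicate; _++_; [_]; map; upTo; foldr)
open import Data.Nat using (ℕ; zero; suc; _≡ᵇ_; _%_)
open import Data.Nat.Combinatorics using (_C_)
open import Relation.Binary.PropositionalEquality using (_≡_)

-- Polynomials over F₂ = Bool (xor as +, ∧ as *), as coefficient lists:
-- the i-th entry of the list is the coefficient of x^i.
Poly : Set
Poly = List Bool

coeff : Poly → ℕ → Bool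
coeff []       _       = false
coeff (a ∷ p)  zero    = a
coeff (a ∷ p)  (suc i) = coeff p i

-- equality in F₂[x]: all coefficients agree (ignores trailing zeros)
infix 4 _≈ₚ_
_≈ₚ_ : Poly → Poly → Set
p ≈ₚ q = ∀ i → coeff p i ≡ coeff q i

0ₚ : Poly
0ₚ = []

1ₚ : Poly
1ₚ = true ∷ []

infixl 6 _+ₚ_
_+ₚ_ : Poly → Poly → Poly
[]      +ₚ q       = q
(a ∷ p) +ₚ []      = a ∷ p
(a ∷ p) +ₚ (b ∷ q) = (a xor b) ∷ (p +ₚ q)

_·ₚ_ : Bool → Poly → Poly
c ·ₚ p = map (c ∧_) p

infixl 7 _*ₚ_
_*ₚ_ : Poly → Poly → Poly
[]      *ₚ q = []
(a ∷ p) *ₚ q = (a ·ₚ q) +ₚ (false ∷ (p *ₚ q))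

X^ : ℕ → Poly
X^ m = replicate m false ++ [ true ]

sumₚ : (ℕ → Poly) → ℕ → Poly
sumₚ f n = foldr (λ j acc → f j +ₚ acc) 0ₚ (upTo n)

prodₚ : (ℕ → Poly) → ℕ → Poly
prodₚ f n = foldr (λ k acc → f k *ₚ acc) 1ₚ (upTo n)

binom₂ : ℕ → ℕ → Bool
binom₂ k j = ((k C j) % 2) ≡ᵇ 1

-- Let K k = ∑_{j ≤ k} (k choose j) x^(2^j). Pascal's rule mod 2 gives K (k+1) = K k + (K k)²,
-- so K k = Dᵏ x for the additive operator D = id + Frob on F₂[x], and K (k+1) = K k (1 + K k),
-- so the product telescopes: x ∏_{k<m} (1 + K k) = K m. Since id and Frob commute and 2 = 0,
-- D^(2^n) = id + Frob^(2^n) (the freshman's dream), whence K (2^n) = x + x^(2^(2^n)); cancelling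
-- the factor x gives the identity.
module Submission where

open import Defs
open import Data.Nat using (ℕ; zero; suc; _+_; _*_; _^_; _∸_; _%_; _≡ᵇ_)

open import Algebra.Bundles using (CommutativeMonoid)
open import Algebra.Definitions using (Congruent₁)
open import Data.Bool using (Bool; true; false; not; _xor_; _∧_)
open import Data.Bool.Properties
  using (xor-comm; xor-assoc; xor-same; xor-identityʳ; ∧-comm; ∧-assoc; ∧-idem; ∧-zeroʳ;
         ∧-identityʳ; ∧-distribˡ-xor; ∧-distribʳ-xor)
open import Data.List using (List; []; _∷_; foldr; upTo)
open import Data.List.Properties using (map-id; map-∘; map-cong; map-upTo; foldr-map)
open import Data.Nat.Combinatorics using (_C_; nCk+nC[k+1]≡[n+1]C[k+1]; k>n⇒nCk≡0)
open import Data.Nat.GeneralisedArithmetic using (fold; fold-+)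
open import Data.Nat.Properties
  using (+-identityʳ; +-suc; n<1+n; suc-pred; m^n≢0; pred[m∸n]≡m∸[1+n])
open import Data.Product using (_,_)
open import Function using (_∘_)
open import Relation.Binary.Bundles using (Setoid)
open import Relation.Binary.Structures using (IsEquivalence)
open import Relation.Binary.PropositionalEquality as ≡ using (_≡_)

foldr-upTo-suc : ∀ {b} {B : Set b} (c : ℕ → B → B) e n →
                 foldr c e (upTo (suc n)) ≡ c 0 (foldr (c ∘ suc) e (upTo n))
foldr-upTo-suc c e n =
  ≡.cong (c 0) (≡.trans (≡.cong (foldr c e) (≡.sym (map-upTo suc n)))
                        (foldr-map c suc e (upTo n)))

fold-2^-suc : ∀ {a} {A : Set a} (x : A) (f : A → A) n →
              fold x f (2 ^ suc n) ≡ fold (fold x f (2 ^ n)) f (2 ^ n)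
fold-2^-suc x f n =
  ≡.trans (≡.cong (λ m → fold x f (2 ^ n + m)) (+-identityʳ (2 ^ n))) (fold-+ x f (2 ^ n))

module FreshmansDream {c ℓ} (M : CommutativeMonoid c ℓ) where

  open CommutativeMonoid M
  open import Algebra.Properties.CommutativeSemigroup commutativeSemigroup using (interchange)
  open import Relation.Binary.Reasoning.Setoid setoid

  fold-cong : ∀ {f} → Congruent₁ _≈_ f → ∀ m {x y} → x ≈ y → fold x f m ≈ fold y f m
  fold-cong f-cong zero    x≈y = x≈y
  fold-cong f-cong (suc m) x≈y = f-cong (fold-cong f-cong m x≈y)

  fold-homo : ∀ {f} → Congruent₁ _≈_ f → (∀ x y → f (x ∙ y) ≈ f x ∙ f y) →
              ∀ m x y → fold (x ∙ y) f m ≈ fold x f m ∙ fold y f m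
  fold-homo f-cong f-homo zero    x y = refl
  fold-homo f-cong f-homo (suc m) x y = trans (f-cong (fold-homo f-cong f-homo m x y)) (f-homo _ _)

  module _ (x∙x≈ε : ∀ x → x ∙ x ≈ ε) {F : Carrier → Carrier}
           (F-cong : Congruent₁ _≈_ F) (F-homo : ∀ x y → F (x ∙ y) ≈ F x ∙ F y) where

    D : Carrier → Carrier
    D x = x ∙ F x

    private
      D-cong : Congruent₁ _≈_ D
      D-cong x≈y = ∙-cong x≈y (F-cong x≈y)

      D-homo : ∀ x y → D (x ∙ y) ≈ D x ∙ D y
      D-homo x y = trans (∙-congˡ (F-homo x y)) (interchange x y (F x) (F y))

      xy∙yz≈xz : ∀ x y z → (x ∙ y) ∙ (y ∙ z) ≈ x ∙ z
      xy∙yz≈xz x y z = begin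
        (x ∙ y) ∙ (y ∙ z) ≈⟨ assoc x y (y ∙ z) ⟩
        x ∙ (y ∙ (y ∙ z)) ≈⟨ ∙-congˡ (assoc y y z) ⟨
        x ∙ ((y ∙ y) ∙ z) ≈⟨ ∙-congˡ (∙-congʳ (x∙x≈ε y)) ⟩
        x ∙ (ε ∙ z)       ≈⟨ ∙-congˡ (identityˡ z) ⟩
        x ∙ z             ∎

    freshmansDream : ∀ n x → fold x D (2 ^ n) ≈ x ∙ fold x F (2 ^ n)
    freshmansDream zero    x = refl
    freshmansDream (suc n) x = begin
      fold x D (2 ^ suc n)            ≡⟨ fold-2^-suc x D n ⟩
      fold (fold x D N) D N           ≈⟨ fold-cong D-cong N (freshmansDream n x) ⟩
      fold (x ∙ Fᴺ x) D N             ≈⟨ fold-homo D-cong D-homo N x (Fᴺ x) ⟩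
      fold x D N ∙ fold (Fᴺ x) D N    ≈⟨ ∙-cong (freshmansDream n x) (freshmansDream n (Fᴺ x)) ⟩
      (x ∙ Fᴺ x) ∙ (Fᴺ x ∙ Fᴺ (Fᴺ x)) ≈⟨ xy∙yz≈xz x (Fᴺ x) (Fᴺ (Fᴺ x)) ⟩
      x ∙ Fᴺ (Fᴺ x)                   ≡⟨ ≡.cong (x ∙_) (fold-2^-suc x F n) ⟨
      x ∙ fold x F (2 ^ suc n)        ∎
      where
      N = 2 ^ n
      Fᴺ : Carrier → Carrier
      Fᴺ y = fold y F N

-- _≈ₚ_ unfolds to a Π-type from which Agda cannot infer the two polynomials;
-- the record wrapper makes them inferable.
infix 4 _≋_
record _≋_ (p q : Poly) : Set where
  constructor mk≋
  field ≋⇒≈ₚ : p ≈ₚ q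
open _≋_

≋-isEquivalence : IsEquivalence _≋_
≋-isEquivalence = record
  { refl  = mk≋ λ _ → ≡.refl
  ; sym   = λ (mk≋ p≈q) → mk≋ λ i → ≡.sym (p≈q i)
  ; trans = λ (mk≋ p≈q) (mk≋ q≈r) → mk≋ λ i → ≡.trans (p≈q i) (q≈r i)
  }

≋-setoid : Setoid _ _
≋-setoid = record { isEquivalence = ≋-isEquivalence }

open Setoid ≋-setoid using ()
  renaming (refl to ≋-refl; sym to ≋-sym; trans to ≋-trans; reflexive to ≋-reflexive)
open import Relation.Binary.Reasoning.Setoid ≋-setoid

∷-cong : ∀ {a b p q} → a ≡ b → p ≋ q → a ∷ p ≋ b ∷ q
∷-cong a≡b (mk≋ p≈q) = mk≋ λ { zero → a≡b ; (suc i) → p≈q i }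

∷≋0ₚ : ∀ {a p} → a ≡ false → p ≋ 0ₚ → a ∷ p ≋ 0ₚ
∷≋0ₚ a≡false (mk≋ p≈0) = mk≋ λ { zero → a≡false ; (suc i) → p≈0 i }

∷-injectiveˡ : ∀ {a b p q} → a ∷ p ≋ b ∷ q → a ≡ b
∷-injectiveˡ (mk≋ a∷p≈b∷q) = a∷p≈b∷q 0

∷-injectiveʳ : ∀ {a b p q} → a ∷ p ≋ b ∷ q → p ≋ q
∷-injectiveʳ (mk≋ a∷p≈b∷q) = mk≋ (a∷p≈b∷q ∘ suc)

coeff-+ₚ : ∀ p q i → coeff (p +ₚ q) i ≡ coeff p i xor coeff q i
coeff-+ₚ []      q       i       = ≡.refl
coeff-+ₚ (a ∷ p) []      i       = ≡.sym (xor-identityʳ (coeff (a ∷ p) i))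
coeff-+ₚ (a ∷ p) (b ∷ q) zero    = ≡.refl
coeff-+ₚ (a ∷ p) (b ∷ q) (suc i) = coeff-+ₚ p q i

coeff-·ₚ : ∀ c p i → coeff (c ·ₚ p) i ≡ c ∧ coeff p i
coeff-·ₚ c []      i       = ≡.sym (∧-zeroʳ c)
coeff-·ₚ c (a ∷ p) zero    = ≡.refl
coeff-·ₚ c (a ∷ p) (suc i) = coeff-·ₚ c p i

+ₚ-cong : ∀ {p p′ q q′} → p ≋ p′ → q ≋ q′ → p +ₚ q ≋ p′ +ₚ q′
+ₚ-cong {p} {p′} {q} {q′} (mk≋ p≈p′) (mk≋ q≈q′) = mk≋ λ i →
  ≡.trans (coeff-+ₚ p q i)
          (≡.trans (≡.cong₂ _xor_ (p≈p′ i) (q≈q′ i)) (≡.sym (coeff-+ₚ p′ q′ i)))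

+ₚ-congˡ : ∀ p {q q′} → q ≋ q′ → p +ₚ q ≋ p +ₚ q′
+ₚ-congˡ p = +ₚ-cong (≋-refl {p})

+ₚ-congʳ : ∀ q {p p′} → p ≋ p′ → p +ₚ q ≋ p′ +ₚ q
+ₚ-congʳ q p≈p′ = +ₚ-cong p≈p′ (≋-refl {q})

+ₚ-identityʳ : ∀ p → p +ₚ 0ₚ ≡ p
+ₚ-identityʳ []      = ≡.refl
+ₚ-identityʳ (a ∷ p) = ≡.refl

+ₚ-comm : ∀ p q → p +ₚ q ≡ q +ₚ p
+ₚ-comm []      q       = ≡.sym (+ₚ-identityʳ q)
+ₚ-comm (a ∷ p) []      = ≡.refl
+ₚ-comm (a ∷ p) (b ∷ q) = ≡.cong₂ _∷_ (xor-comm a b) (+ₚ-comm p q)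

+ₚ-assoc : ∀ p q r → (p +ₚ q) +ₚ r ≡ p +ₚ (q +ₚ r)
+ₚ-assoc []      q       r       = ≡.refl
+ₚ-assoc (a ∷ p) []      r       = ≡.refl
+ₚ-assoc (a ∷ p) (b ∷ q) []      = ≡.refl
+ₚ-assoc (a ∷ p) (b ∷ q) (c ∷ r) = ≡.cong₂ _∷_ (xor-assoc a b c) (+ₚ-assoc p q r)

+ₚ-self : ∀ p → p +ₚ p ≋ 0ₚ
+ₚ-self []      = ≋-refl
+ₚ-self (a ∷ p) = ∷≋0ₚ (xor-same a) (+ₚ-self p)

+ₚ-commutativeMonoid : CommutativeMonoid _ _
+ₚ-commutativeMonoid = record
  { _≈_ = _≋_
  ; _∙_ = _+ₚ_
  ; ε   = 0ₚ
  ; isCommutativeMonoid = record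
    { isMonoid = record
      { isSemigroup = record
        { isMagma = record { isEquivalence = ≋-isEquivalence ; ∙-cong = +ₚ-cong }
        ; assoc   = λ p q r → ≋-reflexive (+ₚ-assoc p q r)
        }
      ; identity = (λ _ → ≋-refl) , (λ p → ≋-reflexive (+ₚ-identityʳ p))
      }
    ; comm = λ p q → ≋-reflexive (+ₚ-comm p q)
    }
  }

open import Algebra.Properties.CommutativeSemigroup
  (CommutativeMonoid.commutativeSemigroup +ₚ-commutativeMonoid)
  using (interchange; x∙yz≈y∙xz; x∙yz≈xz∙y)

·ₚ-cong : ∀ c {p q} → p ≋ q → c ·ₚ p ≋ c ·ₚ q
·ₚ-cong c {p} {q} (mk≋ p≈q) = mk≋ λ i →
  ≡.trans (coeff-·ₚ c p i) (≡.trans (≡.cong (c ∧_) (p≈q i)) (≡.sym (coeff-·ₚ c q i)))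

false-·ₚ : ∀ p → false ·ₚ p ≋ 0ₚ
false-·ₚ p = mk≋ (coeff-·ₚ false p)

true-·ₚ : ∀ p → true ·ₚ p ≡ p
true-·ₚ = map-id

·ₚ-assoc : ∀ a b p → a ·ₚ (b ·ₚ p) ≡ (a ∧ b) ·ₚ p
·ₚ-assoc a b p = ≡.trans (≡.sym (map-∘ p)) (map-cong (λ x → ≡.sym (∧-assoc a b x)) p)

·ₚ-distrib-+ₚ : ∀ c p q → c ·ₚ (p +ₚ q) ≡ c ·ₚ p +ₚ c ·ₚ q
·ₚ-distrib-+ₚ c []      q       = ≡.refl
·ₚ-distrib-+ₚ c (a ∷ p) []      = ≡.refl
·ₚ-distrib-+ₚ c (a ∷ p) (b ∷ q) = ≡.cong₂ _∷_ (∧-distribˡ-xor c a b) (·ₚ-distrib-+ₚ c p q)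

xor-·ₚ : ∀ a b p → (a xor b) ·ₚ p ≡ a ·ₚ p +ₚ b ·ₚ p
xor-·ₚ a b []      = ≡.refl
xor-·ₚ a b (c ∷ p) = ≡.cong₂ _∷_ (∧-distribʳ-xor c a b) (xor-·ₚ a b p)

*ₚ-zeroˡ : ∀ {p} q → p ≋ 0ₚ → p *ₚ q ≋ 0ₚ
*ₚ-zeroˡ {[]}    q p≈0 = ≋-refl
*ₚ-zeroˡ {a ∷ p} q p≈0 =
  +ₚ-cong a·q≋0 (∷≋0ₚ ≡.refl (*ₚ-zeroˡ q (mk≋ {p} (≋⇒≈ₚ p≈0 ∘ suc))))
  where
  a·q≋0 : a ·ₚ q ≋ 0ₚ
  a·q≋0 = ≋-trans (≋-reflexive (≡.cong (_·ₚ q) (≋⇒≈ₚ p≈0 0))) (false-·ₚ q)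

*ₚ-congʳ : ∀ q {p p′} → p ≋ p′ → p *ₚ q ≋ p′ *ₚ q
*ₚ-congʳ q {[]}    {p′}     p≈p′ = ≋-sym (*ₚ-zeroˡ q (≋-sym p≈p′))
*ₚ-congʳ q {a ∷ p} {[]}     p≈p′ = *ₚ-zeroˡ q p≈p′
*ₚ-congʳ q {a ∷ p} {b ∷ p′} p≈p′ =
  +ₚ-cong (≋-reflexive (≡.cong (_·ₚ q) (∷-injectiveˡ p≈p′)))
          (∷-cong ≡.refl (*ₚ-congʳ q (∷-injectiveʳ p≈p′)))

*ₚ-congˡ : ∀ p {q q′} → q ≋ q′ → p *ₚ q ≋ p *ₚ q′
*ₚ-congˡ []      q≈q′ = ≋-refl
*ₚ-congˡ (a ∷ p) q≈q′ = +ₚ-cong (·ₚ-cong a q≈q′) (∷-cong ≡.refl (*ₚ-congˡ p q≈q′))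

*ₚ-cong : ∀ {p p′ q q′} → p ≋ p′ → q ≋ q′ → p *ₚ q ≋ p′ *ₚ q′
*ₚ-cong {p} {p′} {q} {q′} p≈p′ q≈q′ = ≋-trans (*ₚ-congʳ q p≈p′) (*ₚ-congˡ p′ q≈q′)

*ₚ-distribˡ-+ₚ : ∀ p q r → p *ₚ (q +ₚ r) ≋ p *ₚ q +ₚ p *ₚ r
*ₚ-distribˡ-+ₚ []      q r = ≋-refl
*ₚ-distribˡ-+ₚ (a ∷ p) q r = begin
  a ·ₚ (q +ₚ r) +ₚ (false ∷ p *ₚ (q +ₚ r))
    ≈⟨ +ₚ-cong (≋-reflexive (·ₚ-distrib-+ₚ a q r)) (∷-cong ≡.refl (*ₚ-distribˡ-+ₚ p q r)) ⟩
  (a ·ₚ q +ₚ a ·ₚ r) +ₚ ((false ∷ p *ₚ q) +ₚ (false ∷ p *ₚ r))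
    ≈⟨ interchange (a ·ₚ q) (a ·ₚ r) _ _ ⟩
  (a ·ₚ q +ₚ (false ∷ p *ₚ q)) +ₚ (a ·ₚ r +ₚ (false ∷ p *ₚ r)) ∎

*ₚ-distribʳ-+ₚ : ∀ p q r → (p +ₚ q) *ₚ r ≋ p *ₚ r +ₚ q *ₚ r
*ₚ-distribʳ-+ₚ []      q       r = ≋-refl
*ₚ-distribʳ-+ₚ (a ∷ p) []      r = ≋-reflexive (≡.sym (+ₚ-identityʳ _))
*ₚ-distribʳ-+ₚ (a ∷ p) (b ∷ q) r = begin
  (a xor b) ·ₚ r +ₚ (false ∷ (p +ₚ q) *ₚ r)
    ≈⟨ +ₚ-cong (≋-reflexive (xor-·ₚ a b r)) (∷-cong ≡.refl (*ₚ-distribʳ-+ₚ p q r)) ⟩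
  (a ·ₚ r +ₚ b ·ₚ r) +ₚ ((false ∷ p *ₚ r) +ₚ (false ∷ q *ₚ r))
    ≈⟨ interchange (a ·ₚ r) (b ·ₚ r) _ _ ⟩
  (a ·ₚ r +ₚ (false ∷ p *ₚ r)) +ₚ (b ·ₚ r +ₚ (false ∷ q *ₚ r)) ∎

·ₚ-*ₚ : ∀ c p q → (c ·ₚ p) *ₚ q ≋ c ·ₚ (p *ₚ q)
·ₚ-*ₚ c []      q = ≋-refl
·ₚ-*ₚ c (a ∷ p) q = begin
  (c ∧ a) ·ₚ q +ₚ (false ∷ (c ·ₚ p) *ₚ q)
    ≈⟨ +ₚ-cong (≋-reflexive (≡.sym (·ₚ-assoc c a q)))
               (∷-cong (≡.sym (∧-zeroʳ c)) (·ₚ-*ₚ c p q)) ⟩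
  c ·ₚ (a ·ₚ q) +ₚ c ·ₚ (false ∷ p *ₚ q)
    ≡⟨ ·ₚ-distrib-+ₚ c (a ·ₚ q) _ ⟨
  c ·ₚ (a ·ₚ q +ₚ (false ∷ p *ₚ q)) ∎

false∷-*ₚ : ∀ p q → (false ∷ p) *ₚ q ≋ false ∷ p *ₚ q
false∷-*ₚ p q = +ₚ-congʳ (false ∷ p *ₚ q) (false-·ₚ q)

*ₚ-assoc : ∀ p q r → (p *ₚ q) *ₚ r ≋ p *ₚ (q *ₚ r)
*ₚ-assoc []      q r = ≋-refl
*ₚ-assoc (a ∷ p) q r = begin
  (a ·ₚ q +ₚ (false ∷ p *ₚ q)) *ₚ r
    ≈⟨ *ₚ-distribʳ-+ₚ (a ·ₚ q) _ r ⟩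
  (a ·ₚ q) *ₚ r +ₚ (false ∷ p *ₚ q) *ₚ r
    ≈⟨ +ₚ-cong (·ₚ-*ₚ a q r) (false∷-*ₚ (p *ₚ q) r) ⟩
  a ·ₚ (q *ₚ r) +ₚ (false ∷ (p *ₚ q) *ₚ r)
    ≈⟨ +ₚ-congˡ (a ·ₚ (q *ₚ r)) (∷-cong ≡.refl (*ₚ-assoc p q r)) ⟩
  a ·ₚ (q *ₚ r) +ₚ (false ∷ p *ₚ (q *ₚ r)) ∎

*ₚ-identityˡ : ∀ p → 1ₚ *ₚ p ≋ p
*ₚ-identityˡ p = begin
  true ·ₚ p +ₚ (false ∷ []) ≈⟨ +ₚ-congˡ (true ·ₚ p) (∷≋0ₚ ≡.refl ≋-refl) ⟩
  true ·ₚ p +ₚ 0ₚ           ≡⟨ ≡.trans (+ₚ-identityʳ _) (true-·ₚ p) ⟩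
  p                         ∎

*ₚ-identityʳ : ∀ p → p *ₚ 1ₚ ≡ p
*ₚ-identityʳ []      = ≡.refl
*ₚ-identityʳ (a ∷ p) = ≡.cong₂ _∷_ (≡.trans (xor-identityʳ _) (∧-identityʳ a)) (*ₚ-identityʳ p)

*ₚ-consʳ : ∀ p b q → p *ₚ (b ∷ q) ≋ b ·ₚ p +ₚ (false ∷ p *ₚ q)
*ₚ-consʳ []      b q = ≋-sym (∷≋0ₚ ≡.refl ≋-refl)
*ₚ-consʳ (a ∷ p) b q = ∷-cong (≡.cong (_xor false) (∧-comm a b)) (begin
  a ·ₚ q +ₚ p *ₚ (b ∷ q)                 ≈⟨ +ₚ-congˡ (a ·ₚ q) (*ₚ-consʳ p b q) ⟩
  a ·ₚ q +ₚ (b ·ₚ p +ₚ (false ∷ p *ₚ q)) ≈⟨ x∙yz≈y∙xz (a ·ₚ q) (b ·ₚ p) _ ⟩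
  b ·ₚ p +ₚ (a ·ₚ q +ₚ (false ∷ p *ₚ q)) ∎)

-- p ² is p(x²), the Frobenius image of p.
infix 8 _²
_² : Poly → Poly
[]      ² = []
(a ∷ p) ² = a ∷ false ∷ p ²

p*ₚp≋p² : ∀ p → p *ₚ p ≋ p ²
p*ₚp≋p² []      = ≋-refl
p*ₚp≋p² (a ∷ p) = ∷-cong (≡.trans (xor-identityʳ _) (∧-idem a)) (begin
  a ·ₚ p +ₚ p *ₚ (a ∷ p)
    ≈⟨ +ₚ-congˡ (a ·ₚ p) (*ₚ-consʳ p a p) ⟩
  a ·ₚ p +ₚ (a ·ₚ p +ₚ (false ∷ p *ₚ p))
    ≡⟨ +ₚ-assoc (a ·ₚ p) _ _ ⟨
  (a ·ₚ p +ₚ a ·ₚ p) +ₚ (false ∷ p *ₚ p)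
    ≈⟨ +ₚ-congʳ (false ∷ p *ₚ p) (+ₚ-self (a ·ₚ p)) ⟩
  false ∷ p *ₚ p
    ≈⟨ ∷-cong ≡.refl (p*ₚp≋p² p) ⟩
  false ∷ p ² ∎)

²-cong : ∀ {p q} → p ≋ q → p ² ≋ q ²
²-cong {p} {q} p≈q = ≋-trans (≋-sym (p*ₚp≋p² p)) (≋-trans (*ₚ-cong p≈q p≈q) (p*ₚp≋p² q))

²-+ₚ : ∀ p q → (p +ₚ q) ² ≡ p ² +ₚ q ²
²-+ₚ []      q       = ≡.refl
²-+ₚ (a ∷ p) []      = ≡.refl
²-+ₚ (a ∷ p) (b ∷ q) = ≡.cong (λ r → (a xor b) ∷ false ∷ r) (²-+ₚ p q)

²-·ₚ : ∀ c p → (c ·ₚ p) ² ≡ c ·ₚ (p ²)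
²-·ₚ c []      = ≡.refl
²-·ₚ c (a ∷ p) = ≡.cong₂ (λ b r → (c ∧ a) ∷ b ∷ r) (≡.sym (∧-zeroʳ c)) (²-·ₚ c p)

X^-² : ∀ m → X^ m ² ≋ X^ (2 * m)
X^-² zero    = ∷-cong ≡.refl (∷≋0ₚ ≡.refl ≋-refl)
X^-² (suc m) = begin
  false ∷ false ∷ X^ m ²        ≈⟨ ∷-cong ≡.refl (∷-cong ≡.refl (X^-² m)) ⟩
  false ∷ false ∷ X^ (2 * m)    ≡⟨ ≡.cong (λ k → false ∷ X^ k) (+-suc m (m + 0)) ⟨
  X^ (2 * suc m)                ∎

fold-X^-² : ∀ m → fold (X^ 1) _² m ≋ X^ (2 ^ m)
fold-X^-² zero    = ≋-refl
fold-X^-² (suc m) = ≋-trans (²-cong (fold-X^-² m)) (X^-² (2 ^ m))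

-- sumₚ f n is definitionally sumOver f (upTo n).
sumOver : (ℕ → Poly) → List ℕ → Poly
sumOver f = foldr (λ j acc → f j +ₚ acc) 0ₚ

sumOver-cong : ∀ {f g} → (∀ j → f j ≋ g j) → ∀ xs → sumOver f xs ≋ sumOver g xs
sumOver-cong f≈g []       = ≋-refl
sumOver-cong f≈g (x ∷ xs) = +ₚ-cong (f≈g x) (sumOver-cong f≈g xs)

sumOver-+ₚ : ∀ f g xs → sumOver (λ j → f j +ₚ g j) xs ≋ sumOver f xs +ₚ sumOver g xs
sumOver-+ₚ f g []       = ≋-refl
sumOver-+ₚ f g (x ∷ xs) =
  ≋-trans (+ₚ-congˡ (f x +ₚ g x) (sumOver-+ₚ f g xs)) (interchange (f x) (g x) _ _)

²-sumOver : ∀ f xs → sumOver f xs ² ≡ sumOver (λ j → f j ²) xs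
²-sumOver f []       = ≡.refl
²-sumOver f (x ∷ xs) = ≡.trans (²-+ₚ (f x) _) (≡.cong (f x ² +ₚ_) (²-sumOver f xs))

sumₚ-suc : ∀ f n → sumₚ f (suc n) ≡ f 0 +ₚ sumₚ (f ∘ suc) n
sumₚ-suc f = foldr-upTo-suc (λ j acc → f j +ₚ acc) 0ₚ

prodₚ-suc : ∀ f n → prodₚ f (suc n) ≡ f 0 *ₚ prodₚ (f ∘ suc) n
prodₚ-suc f = foldr-upTo-suc (λ k acc → f k *ₚ acc) 1ₚ

sumₚ-vanishing-last : ∀ f n → f n ≋ 0ₚ → sumₚ f (suc n) ≋ sumₚ f n
sumₚ-vanishing-last f zero    fn≈0 = +ₚ-congʳ 0ₚ fn≈0
sumₚ-vanishing-last f (suc n) fn≈0 = begin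
  sumₚ f (suc (suc n))         ≡⟨ sumₚ-suc f (suc n) ⟩
  f 0 +ₚ sumₚ (f ∘ suc) (suc n) ≈⟨ +ₚ-congˡ (f 0) (sumₚ-vanishing-last (f ∘ suc) n fn≈0) ⟩
  f 0 +ₚ sumₚ (f ∘ suc) n       ≡⟨ sumₚ-suc f n ⟨
  sumₚ f (suc n)               ∎

prodₚ-telescope : ∀ (H g : ℕ → Poly) → (∀ i → H (suc i) ≋ H i *ₚ g i) →
                  ∀ m → H 0 *ₚ prodₚ g m ≋ H m
prodₚ-telescope H g step zero    = ≋-reflexive (*ₚ-identityʳ (H 0))
prodₚ-telescope H g step (suc m) = begin
  H 0 *ₚ prodₚ g (suc m)              ≡⟨ ≡.cong (H 0 *ₚ_) (prodₚ-suc g m) ⟩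
  H 0 *ₚ (g 0 *ₚ prodₚ (g ∘ suc) m)   ≈⟨ *ₚ-assoc (H 0) (g 0) _ ⟨
  (H 0 *ₚ g 0) *ₚ prodₚ (g ∘ suc) m   ≈⟨ *ₚ-congʳ (prodₚ (g ∘ suc) m) (step 0) ⟨
  H 1 *ₚ prodₚ (g ∘ suc) m            ≈⟨ prodₚ-telescope (H ∘ suc) (g ∘ suc) (step ∘ suc) m ⟩
  H (suc m)                           ∎

parity : ℕ → Bool
parity m = m % 2 ≡ᵇ 1

parity-suc : ∀ m → parity (suc m) ≡ not (parity m)
parity-suc zero          = ≡.refl
parity-suc (suc zero)    = ≡.refl
parity-suc (suc (suc m)) = parity-suc m

parity-+ : ∀ m n → parity (m + n) ≡ parity m xor parity n
parity-+ zero          n = ≡.refl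
parity-+ (suc zero)    n = parity-suc n
parity-+ (suc (suc m)) n = parity-+ m n

binom₂-pascal : ∀ k j → binom₂ (suc k) (suc j) ≡ binom₂ k j xor binom₂ k (suc j)
binom₂-pascal k j =
  ≡.trans (≡.cong parity (≡.sym (nCk+nC[k+1]≡[n+1]C[k+1] k j))) (parity-+ (k C j) (k C suc j))

binom₂-beyond : ∀ k → binom₂ k (suc k) ≡ false
binom₂-beyond k = ≡.cong parity (k>n⇒nCk≡0 (n<1+n k))

K-term : ℕ → ℕ → Poly
K-term k j = binom₂ k j ·ₚ X^ (2 ^ j)

K : ℕ → Poly
K k = sumₚ (K-term k) (suc k)

K-suc : ∀ k → K (suc k) ≋ K k +ₚ K k ²
K-suc k = begin
  K (suc k)
    ≡⟨ sumₚ-suc (K-term (suc k)) (suc k) ⟩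
  X^ 1 +ₚ sumₚ (K-term (suc k) ∘ suc) (suc k)
    ≈⟨ +ₚ-congˡ (X^ 1) (sumOver-cong pascal (upTo (suc k))) ⟩
  X^ 1 +ₚ sumₚ (λ j → A j +ₚ B j) (suc k)
    ≈⟨ +ₚ-congˡ (X^ 1) (sumOver-+ₚ A B (upTo (suc k))) ⟩
  X^ 1 +ₚ (sumₚ A (suc k) +ₚ sumₚ B (suc k))
    ≈⟨ x∙yz≈xz∙y (X^ 1) (sumₚ A (suc k)) (sumₚ B (suc k)) ⟩
  (X^ 1 +ₚ sumₚ B (suc k)) +ₚ sumₚ A (suc k)
    ≈⟨ +ₚ-cong K≋x+ΣB (≋-sym K²≋ΣA) ⟩
  K k +ₚ K k ² ∎
  where
  A B : ℕ → Poly
  A j = binom₂ k j ·ₚ X^ (2 ^ suc j)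
  B   = K-term k ∘ suc

  pascal : ∀ j → K-term (suc k) (suc j) ≋ A j +ₚ B j
  pascal j = begin
    binom₂ (suc k) (suc j) ·ₚ X^ (2 ^ suc j)
      ≡⟨ ≡.cong (_·ₚ X^ (2 ^ suc j)) (binom₂-pascal k j) ⟩
    (binom₂ k j xor binom₂ k (suc j)) ·ₚ X^ (2 ^ suc j)
      ≡⟨ xor-·ₚ (binom₂ k j) (binom₂ k (suc j)) (X^ (2 ^ suc j)) ⟩
    A j +ₚ B j ∎

  K≋x+ΣB : X^ 1 +ₚ sumₚ B (suc k) ≋ K k
  K≋x+ΣB = begin
    X^ 1 +ₚ sumₚ B (suc k) ≈⟨ +ₚ-congˡ (X^ 1) (sumₚ-vanishing-last B k B-top) ⟩
    X^ 1 +ₚ sumₚ B k       ≡⟨ sumₚ-suc (K-term k) k ⟨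
    K k                    ∎
    where
    B-top : B k ≋ 0ₚ
    B-top = ≋-trans (≋-reflexive (≡.cong (_·ₚ X^ (2 ^ suc k)) (binom₂-beyond k)))
                    (false-·ₚ (X^ (2 ^ suc k)))

  K²≋ΣA : K k ² ≋ sumₚ A (suc k)
  K²≋ΣA = begin
    K k ²                             ≡⟨ ²-sumOver (K-term k) (upTo (suc k)) ⟩
    sumₚ (λ j → K-term k j ²) (suc k) ≈⟨ sumOver-cong K-term-² (upTo (suc k)) ⟩
    sumₚ A (suc k)                    ∎
    where
    K-term-² : ∀ j → K-term k j ² ≋ A j
    K-term-² j = ≋-trans (≋-reflexive (²-·ₚ (binom₂ k j) (X^ (2 ^ j))))
                         (·ₚ-cong (binom₂ k j) (X^-² (2 ^ j)))

K-fold : ∀ k → K k ≋ fold (X^ 1) (λ p → p +ₚ p ²) k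
K-fold zero    = ≋-refl
K-fold (suc k) = ≋-trans (K-suc k) (+ₚ-cong (K-fold k) (²-cong (K-fold k)))

K-2^ : ∀ n → K (2 ^ n) ≋ X^ 1 +ₚ X^ (2 ^ 2 ^ n)
K-2^ n = begin
  K (2 ^ n)                            ≈⟨ K-fold (2 ^ n) ⟩
  fold (X^ 1) (λ p → p +ₚ p ²) (2 ^ n) ≈⟨ freshmansDream +ₚ-self ²-cong ²-homo n (X^ 1) ⟩
  X^ 1 +ₚ fold (X^ 1) _² (2 ^ n)       ≈⟨ +ₚ-congˡ (X^ 1) (fold-X^-² (2 ^ n)) ⟩
  X^ 1 +ₚ X^ (2 ^ 2 ^ n)               ∎
  where
  open FreshmansDream +ₚ-commutativeMonoid

  ²-homo : ∀ p q → (p +ₚ q) ² ≋ p ² +ₚ q ²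
  ²-homo p q = ≋-reflexive (²-+ₚ p q)

K-suc-factor : ∀ k → K (suc k) ≋ K k *ₚ (1ₚ +ₚ K k)
K-suc-factor k = ≋-sym (begin
  K k *ₚ (1ₚ +ₚ K k)         ≈⟨ *ₚ-distribˡ-+ₚ (K k) 1ₚ (K k) ⟩
  K k *ₚ 1ₚ +ₚ K k *ₚ K k    ≈⟨ +ₚ-cong (≋-reflexive (*ₚ-identityʳ (K k))) (p*ₚp≋p² (K k)) ⟩
  K k +ₚ K k ²               ≈⟨ K-suc k ⟨
  K (suc k)                  ∎)

2^n≡1+[2^n∸1] : ∀ n → 2 ^ n ≡ suc (2 ^ n ∸ 1)
2^n≡1+[2^n∸1] n =
  ≡.trans (≡.sym (suc-pred (2 ^ n) {{m^n≢0 2 n}})) (≡.cong suc (pred[m∸n]≡m∸[1+n] (2 ^ n) 0))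

theorem3 : (n : ℕ) →
    prodₚ (λ k → 1ₚ +ₚ sumₚ (λ j → binom₂ k j ·ₚ X^ (2 ^ j)) (suc k)) (2 ^ n)
      ≈ₚ X^ (2 ^ (2 ^ n) ∸ 1) +ₚ 1ₚ
theorem3 n = ≋⇒≈ₚ (∷-injectiveʳ (begin
  false ∷ P                ≈⟨ ∷-cong ≡.refl (*ₚ-identityˡ P) ⟨
  false ∷ 1ₚ *ₚ P          ≈⟨ false∷-*ₚ 1ₚ P ⟨
  K 0 *ₚ P                 ≈⟨ prodₚ-telescope K (λ k → 1ₚ +ₚ K k) K-suc-factor (2 ^ n) ⟩
  K (2 ^ n)                ≈⟨ K-2^ n ⟩
  X^ 1 +ₚ X^ (2 ^ 2 ^ n)   ≡⟨ ≡.cong (λ m → X^ 1 +ₚ X^ m) (2^n≡1+[2^n∸1] (2 ^ n)) ⟩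
  false ∷ 1ₚ +ₚ X^ M       ≡⟨ ≡.cong (false ∷_) (+ₚ-comm 1ₚ (X^ M)) ⟩
  false ∷ X^ M +ₚ 1ₚ       ∎))
  where
  P = prodₚ (λ k → 1ₚ +ₚ K k) (2 ^ n)
  M = 2 ^ 2 ^ n ∸ 1
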